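{- Let $n,r,d,m\in\mathbb{N}$ with $2\le d$ and $d+1\le m\le n-1$. Suppose $H_1,\dots,H_r\subsetneq [n]$ satisfy $H_{j_1}\ne H_{j_2}$ and $|H_{j_1}\cap H_{j_2}|\le d-2$ for all $1\le j_1<j_2\le r$. Then $$\left|\left\{S\in\binom{[n]}{m}: \exists j\in\{1,\dots,r\},\ S\subseteq H_j\right\}\right|\le\binom{n-1}{m}.$$
   Context: $[n]=\{1,\dots,n\}$ and $\binom{H}{m}=\{S\subseteq H: |S|=m\}$. -}

module Defs where

open import Data.Nat using (ℕ; zero; suc; _≟_)
open import Data.Fin using (Fin)
open import Data.Fin.Properties using (any?)
open import Data.Fin.Subset using (Subset; _⊆_; ∣_∣; inside; outside)
open import Data.Fin.Subset.Properties using (_⊆?_)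
open import Data.Vec using ([]; _∷_)
open import Data.List using (List; [_]; map; _++_; filter; length)
open import Data.Product using (_×_; ∃)
open import Relation.Nullary using (Dec)
open import Relation.Nullary.Decidable using (_×-dec_)

allSubsets : (n : ℕ) → List (Subset n)
allSubsets zero = [ [] ]
allSubsets (suc n) = map (outside ∷_) (allSubsets n) ++ map (inside ∷_) (allSubsets n)

Covered : {n r : ℕ} → (m : ℕ) → (Fin r → Subset n) → Subset n → Set
Covered m H S = (∣ S ∣ ≡ m) × ∃ (λ j → S ⊆ H j)
  where open import Relation.Binary.PropositionalEquality using (_≡_)

covered? : {n r : ℕ} → (m : ℕ) → (H : Fin r → Subset n) → (S : Subset n) → Dec (Covered m H S)
covered? m H S = (∣ S ∣ ≟ m) ×-dec any? (λ j → S ⊆? H j)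

coveredCount : (n r m : ℕ) → (Fin r → Subset n) → ℕ
coveredCount n r m H = length (filter (covered? m H) (allSubsets n))

{-# OPTIONS --safe #-}
module Submission where

-- Split the m-sets according to whether they contain the point 0.  Those avoiding 0
-- are covered by the deletion {H ∖ 0}, again a family of proper subsets of the
-- remaining n − 1 points, so induction bounds them by C(n − 2, m).  Those containing 0
-- are covered, after removing 0, by the link {H ∖ 0 : 0 ∈ H}; removing 0 lowers both
-- m and every pairwise intersection by one, so the invariant |H ∩ H′| ≤ m − 2 survives
-- and they number at most C(n − 2, m − 1).  Pascal's rule adds the two bounds up.
-- The deletion fails to consist of proper subsets only when [n] ∖ {0} is a member; but
-- then every other member H meets it in |H ∖ 0| ≤ m − 2 points, so no m-set through 0
-- is covered at all, and the m-sets avoiding 0 number exactly C(n − 1, m).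

open import Defs
open import Data.Nat using (ℕ; _≤_; _∸_; _+_)
open import Data.Nat.Combinatorics using (_C_)
open import Data.Fin using (Fin) renaming (_<_ to _<ᶠ_)
open import Data.Fin.Subset using (Subset; _⊂_; _∩_; ∣_∣; ⊤)
open import Relation.Binary.PropositionalEquality using (_≢_)

open import Level using (0ℓ)
open import Function using (_∘_)
open import Data.Bool using (true; false; _∧_)
open import Data.Nat using (zero; suc; _<_; s≤s⁻¹; _≟_)
open import Data.Nat.Properties
  using (≤-reflexive; ≤-trans; ≤-antisym; ≤∧≢⇒<; <-irrefl; +-comm; +-identityʳ;
         +-mono-≤; +-monoʳ-≤; m≤m+n; m≤n+m; m+[n∸m]≡n; suc-injective; module ≤-Reasoning)
open import Data.Nat.Combinatorics using (nCk+nC[k+1]≡[n+1]C[k+1])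
open import Data.Fin.Subset using (_⊆_; inside; outside)
open import Data.Fin.Subset.Properties
  using (_⊆?_; drop-∷-⊆; ∣p∣≤n; ∣p∣≤∣x∷p∣; ∣p∣≡n⇒p≡⊤; p⊆q⇒∣p∣≤∣q∣; ∩-comm; ∩-identityʳ)
open import Data.Vec using (_∷_; tail)
import Data.Vec.Base as Vec
open import Data.Vec.Properties using (≡-dec)
open import Data.Bool.Properties using () renaming (_≟_ to _≟ᵇ_)
open import Data.List using (List; []; _∷_; map; filter; length; tabulate; _++_)
open import Data.List.Properties using (filter-++; filter-none; length-++; length-map)
open import Data.List.Relation.Unary.All as All using (All; []; _∷_)
open import Data.List.Relation.Unary.All.Properties using (¬Any⇒All¬)
import Data.List.Relation.Unary.All.Properties as All
open import Data.List.Relation.Unary.Any as Any using (Any; here; there; any?)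
import Data.List.Relation.Unary.Any.Properties as Any
open import Data.List.Relation.Unary.AllPairs as AllPairs using (AllPairs; []; _∷_)
import Data.List.Relation.Unary.AllPairs.Properties as AllPairs
open import Data.List.Membership.Propositional using (_∈_; _∉_; find)
open import Data.List.Relation.Binary.Sublist.Propositional using (⊆-refl)
open import Data.List.Relation.Binary.Sublist.Propositional.Properties using (filter⁺; length-mono-≤)
open import Data.Product using (_×_; _,_; proj₁)
open import Relation.Nullary using (¬_; yes; no; does; contradiction)
open import Relation.Nullary.Decidable using (_×-dec_)
open import Relation.Unary using (Pred; Decidable)
open import Relation.Binary using (Rel; Symmetric)
open import Relation.Binary.PropositionalEquality
  using (_≡_; refl; sym; trans; cong; cong₂; module ≡-Reasoning)

private variable
  n : ℕ

module _ {A B : Set} {P : Pred A 0ℓ} (P? : Decidable P) (f : B → A) where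

  filter-map : ∀ xs → filter P? (map f xs) ≡ map f (filter (P? ∘ f) xs)
  filter-map [] = refl
  filter-map (x ∷ xs) with does (P? (f x))
  ... | true  = cong (f x ∷_) (filter-map xs)
  ... | false = filter-map xs

count : {P : Pred (Subset n) 0ℓ} → Decidable P → ℕ
count {n} P? = length (filter P? (allSubsets n))

count-mono : {P Q : Pred (Subset n) 0ℓ} (P? : Decidable P) (Q? : Decidable Q) →
             (∀ {S} → P S → Q S) → count P? ≤ count Q?
count-mono {n} P? Q? P⇒Q =
  length-mono-≤ (filter⁺ P? Q? (λ { refl → P⇒Q }) (⊆-refl {x = allSubsets n}))

count-cong : {P Q : Pred (Subset n) 0ℓ} (P? : Decidable P) (Q? : Decidable Q) →
             (∀ {S} → P S → Q S) → (∀ {S} → Q S → P S) → count P? ≡ count Q?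
count-cong P? Q? P⇒Q Q⇒P = ≤-antisym (count-mono P? Q? P⇒Q) (count-mono Q? P? Q⇒P)

count-none : {P : Pred (Subset n) 0ℓ} (P? : Decidable P) → (∀ S → ¬ P S) → count P? ≡ 0
count-none {n} P? ¬P = cong length (filter-none P? (All.universal ¬P (allSubsets n)))

count-∷ : {P : Pred (Subset (suc n)) 0ℓ} (P? : Decidable P) →
          count P? ≡ count (P? ∘ (outside ∷_)) + count (P? ∘ (inside ∷_))
count-∷ {n} P? = begin
  length (filter P? (map (outside ∷_) Ss ++ map (inside ∷_) Ss))
    ≡⟨ cong length (filter-++ P? (map (outside ∷_) Ss) _) ⟩
  length (filter P? (map (outside ∷_) Ss) ++ filter P? (map (inside ∷_) Ss))
    ≡⟨ length-++ (filter P? (map (outside ∷_) Ss)) ⟩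
  length (filter P? (map (outside ∷_) Ss)) + length (filter P? (map (inside ∷_) Ss))
    ≡⟨ cong₂ _+_ (count-map outside) (count-map inside) ⟩
  count (P? ∘ (outside ∷_)) + count (P? ∘ (inside ∷_))
    ∎
  where
  open ≡-Reasoning
  Ss = allSubsets n
  count-map : ∀ b → length (filter P? (map (b ∷_) Ss)) ≡ count (P? ∘ (b ∷_))
  count-map b = trans (cong length (filter-map P? (b ∷_) Ss))
                      (length-map (b ∷_) (filter (P? ∘ (b ∷_)) Ss))

count-∷-≤ : {P : Pred (Subset (suc n)) 0ℓ} (P? : Decidable P) {a b : ℕ} →
            count (P? ∘ (outside ∷_)) ≤ a → count (P? ∘ (inside ∷_)) ≤ b → count P? ≤ a + b
count-∷-≤ P? outside≤a inside≤b = ≤-trans (≤-reflexive (count-∷ P?)) (+-mono-≤ outside≤a inside≤b)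

count-size : ∀ n m → count (λ (S : Subset n) → ∣ S ∣ ≟ m) ≡ n C m
count-size zero    zero    = refl
count-size zero    (suc m) = refl
count-size (suc n) zero    = begin
  count {suc n} (λ S → ∣ S ∣ ≟ 0)
    ≡⟨ count-∷ {n} (λ S → ∣ S ∣ ≟ 0) ⟩
  count {n} (λ S → ∣ S ∣ ≟ 0) + count {n} (λ S → suc ∣ S ∣ ≟ 0)
    ≡⟨ cong₂ _+_ (count-size n zero) (count-none {n} (λ S → suc ∣ S ∣ ≟ 0) (λ _ ())) ⟩
  1
    ∎
  where open ≡-Reasoning
count-size (suc n) (suc m) = begin
  count {suc n} (λ S → ∣ S ∣ ≟ suc m)
    ≡⟨ count-∷ {n} (λ S → ∣ S ∣ ≟ suc m) ⟩
  count {n} (λ S → ∣ S ∣ ≟ suc m) + count {n} (λ S → suc ∣ S ∣ ≟ suc m)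
    ≡⟨ cong₂ _+_ (count-size n (suc m)) (trans drop-inside (count-size n m)) ⟩
  n C suc m + n C m
    ≡⟨ +-comm (n C suc m) (n C m) ⟩
  n C m + n C suc m
    ≡⟨ nCk+nC[k+1]≡[n+1]C[k+1] n m ⟩
  suc n C suc m
    ∎
  where
  open ≡-Reasoning
  drop-inside : count {n} (λ S → suc ∣ S ∣ ≟ suc m) ≡ count {n} (λ S → ∣ S ∣ ≟ m)
  drop-inside = count-cong {n} (λ S → suc ∣ S ∣ ≟ suc m) (λ S → ∣ S ∣ ≟ m) suc-injective (cong suc)

module _ {A : Set} {R : Rel A 0ℓ} where

  AllPairs-∈ : Symmetric R → ∀ {x y xs} → AllPairs R xs → x ∈ xs → y ∈ xs → x ≢ y → R x y
  AllPairs-∈ sym (_ ∷ _)       (here refl) (here refl) x≢y = contradiction refl x≢y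
  AllPairs-∈ sym (Rx ∷ _)      (here refl) (there y∈)  _   = All.lookup Rx y∈
  AllPairs-∈ sym (Ry ∷ _)      (there x∈)  (here refl) _   = sym (All.lookup Ry x∈)
  AllPairs-∈ sym (_ ∷ pairs)   (there x∈)  (there y∈)  x≢y = AllPairs-∈ sym pairs x∈ y∈ x≢y

⊂⇒≢ : {p q : Subset n} → p ⊂ q → p ≢ q
⊂⇒≢ (_ , _ , x∈q , x∉p) refl = x∉p x∈q

≢⊤⇒∣p∣<n : {p : Subset n} → p ≢ ⊤ → ∣ p ∣ < n
≢⊤⇒∣p∣<n {p = p} p≢⊤ = ≤∧≢⇒< (∣p∣≤n p) (p≢⊤ ∘ ∣p∣≡n⇒p≡⊤)

⊆-tail : ∀ {b} {S : Subset n} {H} → b ∷ S ⊆ H → S ⊆ tail H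
⊆-tail {H = _ ∷ _} = drop-∷-⊆

∣tail-∩∣≤∣∩∣ : (G H : Subset (suc n)) → ∣ tail G ∩ tail H ∣ ≤ ∣ G ∩ H ∣
∣tail-∩∣≤∣∩∣ (b ∷ G) (c ∷ H) = ∣p∣≤∣x∷p∣ (b ∧ c) (G ∩ H)

IntersectBelow : ℕ → Rel (Subset n) 0ℓ
IntersectBelow m G H = 2 + ∣ G ∩ H ∣ ≤ m

IntersectBelow-sym : ∀ {m} (G H : Subset n) → IntersectBelow m G H → IntersectBelow m H G
IntersectBelow-sym G H = ≤-trans (≤-reflexive (cong (λ X → 2 + ∣ X ∣) (∩-comm H G)))

CoveredBy : ℕ → List (Subset n) → Pred (Subset n) 0ℓ
CoveredBy m Hs S = ∣ S ∣ ≡ m × Any (S ⊆_) Hs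

coveredBy? : ∀ m (Hs : List (Subset n)) → Decidable (CoveredBy m Hs)
coveredBy? m Hs S = (∣ S ∣ ≟ m) ×-dec any? (S ⊆?_) Hs

deletion : List (Subset (suc n)) → List (Subset n)
deletion = map tail

link : List (Subset (suc n)) → List (Subset n)
link []                    = []
link ((outside ∷ H) ∷ Hs) = link Hs
link ((inside  ∷ H) ∷ Hs) = H ∷ link Hs

⊤∖zero : Subset (suc n)
⊤∖zero = outside ∷ ⊤

deletion-covers : ∀ {m} {Hs : List (Subset (suc n))} {S} →
                  CoveredBy m Hs (outside ∷ S) → CoveredBy m (deletion Hs) S
deletion-covers (|S|≡m , S⊆H) = |S|≡m , Any.map⁺ (Any.map ⊆-tail S⊆H)

deletion-proper : {Hs : List (Subset (suc n))} →
                  ⊤∖zero ∉ Hs → All (_≢ ⊤) Hs → All (_≢ ⊤) (deletion Hs)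
deletion-proper ⊤∖zero∉Hs proper =
  All.map⁺ (All.zipWith tail-proper (¬Any⇒All¬ _ ⊤∖zero∉Hs , proper))
  where
  tail-proper : ∀ {H} → ⊤∖zero ≢ H × H ≢ ⊤ → tail H ≢ ⊤
  tail-proper {outside ∷ H} (H≢⊤ , _) refl = H≢⊤ refl
  tail-proper {inside  ∷ H} (_ , H≢⊤) refl = H≢⊤ refl

deletion-pairs : ∀ {m} {Hs : List (Subset (suc n))} →
                 AllPairs (IntersectBelow m) Hs → AllPairs (IntersectBelow m) (deletion Hs)
deletion-pairs = AllPairs.map⁺ ∘ AllPairs.map (λ {G} {H} → ≤-trans (+-monoʳ-≤ 2 (∣tail-∩∣≤∣∩∣ G H)))

module _ {P : Pred (Subset (suc n)) 0ℓ} {Q : Pred (Subset n) 0ℓ}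
         (P⇒Q : ∀ {H} → P (inside ∷ H) → Q H) where

  link-All : ∀ {Hs} → All P Hs → All Q (link Hs)
  link-All {[]}                  []         = []
  link-All {(outside ∷ H) ∷ Hs} (_ ∷ Ps)   = link-All Ps
  link-All {(inside  ∷ H) ∷ Hs} (PH ∷ Ps)  = P⇒Q PH ∷ link-All Ps

link-proper : {Hs : List (Subset (suc n))} → All (_≢ ⊤) Hs → All (_≢ ⊤) (link Hs)
link-proper = link-All (λ H≢⊤ → H≢⊤ ∘ cong (inside ∷_))

link-pairs : ∀ {m} {Hs : List (Subset (suc n))} →
             AllPairs (IntersectBelow (suc m)) Hs → AllPairs (IntersectBelow m) (link Hs)
link-pairs {Hs = []}                 []             = []
link-pairs {Hs = (outside ∷ H) ∷ Hs} (_ ∷ pairs)    = link-pairs pairs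
link-pairs {Hs = (inside  ∷ H) ∷ Hs} (RH ∷ pairs)   = link-All s≤s⁻¹ RH ∷ link-pairs pairs

Any-⊆-link : ∀ {Hs : List (Subset (suc n))} {S} → Any (inside ∷ S ⊆_) Hs → Any (S ⊆_) (link Hs)
Any-⊆-link {Hs = (outside ∷ H) ∷ Hs} (here S⊆H)  with () ← S⊆H Vec.here
Any-⊆-link {Hs = (inside  ∷ H) ∷ Hs} (here S⊆H)  = here (drop-∷-⊆ S⊆H)
Any-⊆-link {Hs = (outside ∷ H) ∷ Hs} (there S⊆H) = Any-⊆-link S⊆H
Any-⊆-link {Hs = (inside  ∷ H) ∷ Hs} (there S⊆H) = there (Any-⊆-link S⊆H)

link-covers : ∀ {m} {Hs : List (Subset (suc n))} {S} →
              CoveredBy (suc m) Hs (inside ∷ S) → CoveredBy m (link Hs) S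
link-covers (|S|≡m , S⊆H) = suc-injective |S|≡m , Any-⊆-link S⊆H

⊤∖zero-blocks-inside : ∀ {m} {Hs : List (Subset (suc n))} {S} → ⊤∖zero ∈ Hs →
                       AllPairs (IntersectBelow (suc m)) Hs → ¬ CoveredBy (suc m) Hs (inside ∷ S)
⊤∖zero-blocks-inside {n} {m} {S = S} ⊤∖zero∈Hs pairs (|S|≡m , S⊆H) with find S⊆H
... | G , G∈Hs , S⊆G = <-irrefl refl (begin-strict
  m                              ≡⟨ suc-injective (sym |S|≡m) ⟩
  ∣ S ∣                          ≤⟨ p⊆q⇒∣p∣≤∣q∣ (⊆-tail S⊆G) ⟩
  ∣ tail G ∣                     ≡⟨ ∣tail∣≡∣∩⊤∖zero∣ G ⟩
  ∣ G ∩ ⊤∖zero ∣                 <⟨ s≤s⁻¹ (AllPairs-∈ (λ {G} {H} → IntersectBelow-sym G H)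
                                                      pairs G∈Hs ⊤∖zero∈Hs G≢⊤∖zero) ⟩
  m                              ∎)
  where
  open ≤-Reasoning
  G≢⊤∖zero : G ≢ ⊤∖zero
  G≢⊤∖zero refl with () ← S⊆G Vec.here
  ∣tail∣≡∣∩⊤∖zero∣ : (G : Subset (suc n)) → ∣ tail G ∣ ≡ ∣ G ∩ ⊤∖zero ∣
  ∣tail∣≡∣∩⊤∖zero∣ (outside ∷ G) = cong ∣_∣ (sym (∩-identityʳ G))
  ∣tail∣≡∣∩⊤∖zero∣ (inside  ∷ G) = cong ∣_∣ (sym (∩-identityʳ G))

⊤∖zero∈⇒count-coveredBy-≤ : ∀ {m} {Hs : List (Subset (suc (suc n)))} → ⊤∖zero ∈ Hs →
                             AllPairs (IntersectBelow (suc m)) Hs →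
                             count (coveredBy? (suc m) Hs) ≤ suc n C suc m
⊤∖zero∈⇒count-coveredBy-≤ {n} {m} {Hs} ⊤∖zero∈Hs pairs = begin
  count (coveredBy? (suc m) Hs)
    ≤⟨ count-∷-≤ (coveredBy? (suc m) Hs)
         (count-mono _ (λ (S : Subset (suc n)) → ∣ S ∣ ≟ suc m) proj₁)
         (≤-reflexive (count-none (coveredBy? (suc m) Hs ∘ (inside ∷_))
                                  (λ _ → ⊤∖zero-blocks-inside ⊤∖zero∈Hs pairs))) ⟩
  count (λ (S : Subset (suc n)) → ∣ S ∣ ≟ suc m) + 0
    ≡⟨ +-identityʳ _ ⟩
  count (λ (S : Subset (suc n)) → ∣ S ∣ ≟ suc m)
    ≡⟨ count-size (suc n) (suc m) ⟩
  suc n C suc m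
    ∎
  where open ≤-Reasoning

count-coveredBy-≤ : ∀ n m (Hs : List (Subset (suc n))) → All (_≢ ⊤) Hs →
                    AllPairs (IntersectBelow m) Hs → count (coveredBy? m Hs) ≤ n C m
count-coveredBy-≤ n zero Hs _ _ =
  ≤-trans (count-mono (coveredBy? 0 Hs) (λ (S : Subset (suc n)) → ∣ S ∣ ≟ 0) proj₁)
          (≤-reflexive (count-size (suc n) 0))
count-coveredBy-≤ zero (suc m) Hs proper _ = ≤-reflexive (count-none (coveredBy? (suc m) Hs) uncovered)
  where
  uncovered : ∀ S → ¬ CoveredBy (suc m) Hs S
  uncovered S (|S|≡m , S⊆Hs) with find S⊆Hs
  ... | H , H∈Hs , S⊆H
    with () ← ≤-trans (≤-reflexive (sym |S|≡m))
                (≤-trans (p⊆q⇒∣p∣≤∣q∣ S⊆H) (s≤s⁻¹ (≢⊤⇒∣p∣<n (All.lookup proper H∈Hs))))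
count-coveredBy-≤ (suc n) (suc m) Hs proper pairs with any? (≡-dec _≟ᵇ_ ⊤∖zero) Hs
... | yes ⊤∖zero∈Hs = ⊤∖zero∈⇒count-coveredBy-≤ ⊤∖zero∈Hs pairs
... | no  ⊤∖zero∉Hs = begin
  count (coveredBy? (suc m) Hs)
    ≤⟨ count-∷-≤ (coveredBy? (suc m) Hs)
         (≤-trans (count-mono _ (coveredBy? (suc m) (deletion Hs)) deletion-covers)
                  (count-coveredBy-≤ n (suc m) (deletion Hs)
                                     (deletion-proper ⊤∖zero∉Hs proper) (deletion-pairs pairs)))
         (≤-trans (count-mono _ (coveredBy? m (link Hs)) link-covers)
                  (count-coveredBy-≤ n m (link Hs) (link-proper proper) (link-pairs pairs))) ⟩
  n C suc m + n C m
    ≡⟨ +-comm (n C suc m) (n C m) ⟩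
  n C m + n C suc m
    ≡⟨ nCk+nC[k+1]≡[n+1]C[k+1] n m ⟩
  suc n C suc m
    ∎
  where open ≤-Reasoning

lemma2p5 : (n r d m : ℕ) → 2 ≤ d → d + 1 ≤ m → m ≤ n ∸ 1 →
    (H : Fin r → Subset n) →
    (∀ j → H j ⊂ ⊤) →
    (∀ j₁ j₂ → j₁ <ᶠ j₂ → H j₁ ≢ H j₂) →
    (∀ j₁ j₂ → j₁ <ᶠ j₂ → ∣ H j₁ ∩ H j₂ ∣ ≤ d ∸ 2) →
    coveredCount n r m H ≤ (n ∸ 1) C m
lemma2p5 zero r d m _ d+1≤m m≤0 _ _ _ _
  with () ← ≤-trans (m≤n+m 1 d) (≤-trans d+1≤m m≤0)
lemma2p5 (suc n) r d m 2≤d d+1≤m _ H H⊂⊤ _ small =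
  ≤-trans (count-mono (covered? m H) (coveredBy? m (tabulate H))
                      (λ (|S|≡m , j , S⊆Hj) → |S|≡m , Any.tabulate⁺ j S⊆Hj))
          (count-coveredBy-≤ n m (tabulate H) (All.tabulate⁺ (⊂⇒≢ ∘ H⊂⊤))
                             (AllPairs.tabulate⁺-< pairwise))
  where
  pairwise : ∀ {j₁ j₂} → j₁ <ᶠ j₂ → IntersectBelow m (H j₁) (H j₂)
  pairwise {j₁} {j₂} j₁<j₂ = begin
    2 + ∣ H j₁ ∩ H j₂ ∣  ≤⟨ +-monoʳ-≤ 2 (small j₁ j₂ j₁<j₂) ⟩
    2 + (d ∸ 2)         ≡⟨ m+[n∸m]≡n 2≤d ⟩
    d                   ≤⟨ ≤-trans (m≤m+n d 1) d+1≤m ⟩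
    m                   ∎
    where open ≤-Reasoning
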